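{- Let $S$ be a real quadratic space of signature $(1,r)$, $r\ge0$, with quadratic form $q_S$ and bilinear form $(x,y)_S=q_S(x+y)-q_S(x)-q_S(y)$, a fixed $1_S\in S$ with $q_S(1_S)=1$, and the involution $\iota_S$ with $\iota_S(1_S)=1_S$ and $\iota_S=-\mathrm{Id}$ on $1_S^\perp$. Let $J=\mathbb{R}\times S$ with $N((\beta,t))=\beta q_S(t)$, $(\beta,t)^\#=(q_S(t),\beta\iota_S(t))$, $1_J=(1,1_S)$, and $((\beta,t),(\beta',t'))_J=\beta\beta'+(t,\iota_S(t'))_S$. Then $J$ is a cubic norm structure. Furthermore, let $V=\mathbb{R}\oplus S\oplus\mathbb{R}$ with $q_V((\alpha,s,\beta))=\alpha\beta-q_S(s)$ and $(x,y)_V=q_V(x+y)-q_V(x)-q_V(y)$, let $V_2=\mathbb{R}e\oplus\mathbb{R}f$ with symplectic form $\langle e,f\rangle=1$, and identify $V_2\otimes V$ with $W_J=\mathbb{R}\oplus J\oplus J\oplus\mathbb{R}$ via \[e\otimes(\alpha,s,\beta)+f\otimes(\gamma,t,\delta)\mapsto(\alpha,(\gamma,s),(\beta,\iota_S(t)),\delta).\] Under this identification, the symplectic form $\langle v\otimes x,v'\otimes x'\rangle=\langle v,v'\rangle(x,x')_V$ and the quartic form $Q(e\otimes x+f\otimes y)=(x,y)_V^2-4q_V(x)q_V(y)$ on $V_2\otimes V$ coincide with Freudenthal's symplectic form $\langle(a,b,c,d),(a',b',c',d')\rangle=ad'-(b,c')+(c,b')-da'$ and quartic form $q((a,b,c,d))=(ad-(b,c))^2+4aN(c)+4dN(b)-4(b^\#,c^\#)$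 on $W_J$ (with $(\,,\,)=(\,,\,)_J$).
   Context: A cubic norm structure over $\mathbb{R}$ is a finite-dimensional vector space $J$ with a cubic polynomial $N$, a quadratic map $\#$, an element $1_J$ and a symmetric bilinear form $(\,,\,)$ such that, with $x\times y=(x+y)^\#-x^\#-y^\#$ and $(\,,\,,\,)$ the symmetric trilinear form with $(x,x,x)=6N(x)$: $N(1_J)=1$, $1_J^\#=1_J$, $1_J\times x=(1_J,x)1_J-x$, $(x^\#)^\#=N(x)x$, $(x,y)=(1_J,1_J,x)(1_J,1_J,y)-(1_J,x,y)$, and $N(x+y)=N(x)+(x^\#,y)+(x,y^\#)+N(y)$ for all $x,y$. -}

module Defs where

open import Data.Nat using (ℕ; zero; suc)
open import Data.Fin using (Fin; zero; suc)
open import Data.Vec using (Vec; lookup; tabulate; zipWith; map)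
open import Data.Product using (Σ; ∃; ∃₂; _×_; _,_)
open import Data.Sum using (_⊎_)
open import Function using (_∘_)
open import Relation.Binary.PropositionalEquality using (_≡_; _≢_)
open import Algebra.Structures using (IsCommutativeRing)

-- The real numbers, axiomatised as a complete ordered field
-- (any model is isomorphic to ℝ).  Equality is propositional equality.

record RealField : Set₁ where
  infixl 6 _+_
  infixl 7 _*_
  infix 4 _≤_
  field
    ℝ : Set
    _+_ _*_ : ℝ → ℝ → ℝ
    -_ : ℝ → ℝ
    0# 1# : ℝ
    _≤_ : ℝ → ℝ → Set
    isCommutativeRing : IsCommutativeRing _≡_ _+_ _*_ -_ 0# 1#
    0≢1 : 0# ≢ 1#
    inverse : ∀ x → x ≢ 0# → ∃ λ y → x * y ≡ 1#
    ≤-refl : ∀ x → x ≤ x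
    ≤-trans : ∀ {x y z} → x ≤ y → y ≤ z → x ≤ z
    ≤-antisym : ∀ {x y} → x ≤ y → y ≤ x → x ≡ y
    ≤-total : ∀ x y → (x ≤ y) ⊎ (y ≤ x)
    +-mono-≤ : ∀ {x y} z → x ≤ y → x + z ≤ y + z
    *-nonneg : ∀ {x y} → 0# ≤ x → 0# ≤ y → 0# ≤ x * y
    sup : (P : ℝ → Set) → ∃ P → (∃ λ b → ∀ x → P x → x ≤ b) →
          ∃ λ s → (∀ x → P x → x ≤ s) × (∀ b → (∀ x → P x → x ≤ b) → s ≤ b)

module WithReals (R : RealField) where
  open RealField R public

  infixl 6 _-_
  _-_ : ℝ → ℝ → ℝ
  x - y = x + (- y)

  2# 4# 6# : ℝ
  2# = 1# + 1#
  4# = 2# + 2#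
  6# = 4# + 2#

  _² : ℝ → ℝ
  x ² = x * x

  infixl 6 _+ᵥ_
  infixr 7 _·ᵥ_
  _+ᵥ_ : ∀ {n} → Vec ℝ n → Vec ℝ n → Vec ℝ n
  _+ᵥ_ = zipWith _+_

  _·ᵥ_ : ∀ {n} → ℝ → Vec ℝ n → Vec ℝ n
  c ·ᵥ x = map (c *_) x

  -ᵥ_ : ∀ {n} → Vec ℝ n → Vec ℝ n
  -ᵥ x = map (λ a → - a) x

  sumF : ∀ {m} → (Fin m → ℝ) → ℝ
  sumF {zero} f = 0#
  sumF {suc m} f = f zero + sumF (f ∘ suc)

  δ : ∀ {m} → Fin m → Fin m → ℝ
  δ zero zero = 1#
  δ zero (suc _) = 0#
  δ (suc _) zero = 0#
  δ (suc i) (suc j) = δ i j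

  Mat : ℕ → Set
  Mat n = Fin n → Fin n → ℝ

  _$ₘ_ : ∀ {n} → Mat n → Vec ℝ n → Vec ℝ n
  P $ₘ x = tabulate λ i → sumF λ j → P i j * lookup x j

  _∙ₘ_ : ∀ {n} → Mat n → Mat n → Mat n
  (P ∙ₘ Q) i k = sumF λ j → P i j * Q j k

  polar : ∀ {A : Set} → (A → A → A) → (A → ℝ) → A → A → ℝ
  polar _⊕_ q x y = q (x ⊕ y) - q x - q y

  -- q : ℝ^(1+r) → ℝ is a (nondegenerate) quadratic form of signature (1,r):
  -- in some basis (columns of an invertible matrix P) it is x₀² - x₁² - … - x_r².
  HasSignature1 : ∀ r → (Vec ℝ (suc r) → ℝ) → Set
  HasSignature1 r q =
    ∃₂ λ (P P⁻¹ : Mat (suc r)) →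
      (∀ i k → (P ∙ₘ P⁻¹) i k ≡ δ i k) ×
      (∀ i k → (P⁻¹ ∙ₘ P) i k ≡ δ i k) ×
      (∀ x → q (P $ₘ x) ≡ (lookup x zero) ² - sumF (λ i → (lookup x (suc i)) ²))

  -- ι is the involution fixing 1_S and acting as -Id on 1_S^⊥
  -- (with respect to (x,y)_S = q(x+y)-q(x)-q(y)); ι is required to be linear.
  IsStdInvolution : ∀ {n} → (Vec ℝ n → ℝ) → Vec ℝ n → (Vec ℝ n → Vec ℝ n) → Set
  IsStdInvolution q 1S ι =
    (∀ x y → ι (x +ᵥ y) ≡ ι x +ᵥ ι y) ×
    (∀ c x → ι (c ·ᵥ x) ≡ c ·ᵥ ι x) ×
    (ι 1S ≡ 1S) ×
    (∀ x → polar _+ᵥ_ q x 1S ≡ 0# → ι x ≡ -ᵥ x)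

  -- Real vector spaces (only the operations are needed to state
  -- multilinearity; the concrete spaces used below are ℝ × ℝⁿ).

  record VecOps : Set₁ where
    field
      Carrier : Set
      _⊕_ : Carrier → Carrier → Carrier
      _⊙_ : ℝ → Carrier → Carrier

  module _ (A : VecOps) where
    open VecOps A

    IsSymBilinearForm : (Carrier → Carrier → ℝ) → Set
    IsSymBilinearForm B =
      (∀ x y → B x y ≡ B y x) ×
      (∀ x x' y → B (x ⊕ x') y ≡ B x y + B x' y) ×
      (∀ c x y → B (c ⊙ x) y ≡ c * B x y)

    IsBilinearMap : (Carrier → Carrier → Carrier) → Set
    IsBilinearMap B =
      (∀ x x' y → B (x ⊕ x') y ≡ B x y ⊕ B x' y) ×
      (∀ c x y → B (c ⊙ x) y ≡ c ⊙ B x y) ×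
      (∀ x y y' → B x (y ⊕ y') ≡ B x y ⊕ B x y') ×
      (∀ c x y → B x (c ⊙ y) ≡ c ⊙ B x y)

    IsSymTrilinearForm : (Carrier → Carrier → Carrier → ℝ) → Set
    IsSymTrilinearForm T =
      (∀ x y z → T x y z ≡ T y x z) ×
      (∀ x y z → T x y z ≡ T x z y) ×
      (∀ x x' y z → T (x ⊕ x') y z ≡ T x y z + T x' y z) ×
      (∀ c x y z → T (c ⊙ x) y z ≡ c * T x y z)

    IsQuadraticMap : (Carrier → Carrier) → Set
    IsQuadraticMap f = ∃ λ B → IsBilinearMap B × (∀ x → f x ≡ B x x)

    -- Cubic norm structure (J, N, #, 1_J, ( , )).  N is a cubic form,
    -- witnessed by the symmetric trilinear form ( , , ) with (x,x,x) = 6N(x).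
    IsCubicNormStructure :
      (N : Carrier → ℝ) (# : Carrier → Carrier) (1J : Carrier)
      (form : Carrier → Carrier → ℝ) → Set
    IsCubicNormStructure N # 1J form =
      IsQuadraticMap # × IsSymBilinearForm form ×
      ∃ λ (T : Carrier → Carrier → Carrier → ℝ) →
        IsSymTrilinearForm T ×
        (∀ x → T x x x ≡ 6# * N x) ×
        (N 1J ≡ 1#) ×
        (# 1J ≡ 1J) ×
        (∀ x → cross 1J x ≡ (form 1J x ⊙ 1J) ⊕ ((- 1#) ⊙ x)) ×
        (∀ x → # (# x) ≡ N x ⊙ x) ×
        -- trace form: (x,y) = T(x)T(y) - (1,x,y), with T(x) = (1,1,x)/2
        (∀ x y → 4# * form x y ≡ T 1J 1J x * T 1J 1J y - 4# * T 1J x y) ×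
        (∀ x y → N (x ⊕ y) ≡ N x + form (# x) y + form x (# y) + N y)
      where
      cross : Carrier → Carrier → Carrier
      cross x y = # (x ⊕ y) ⊕ (((- 1#) ⊙ # x) ⊕ ((- 1#) ⊙ # y))

  module Construction {n : ℕ} (qS : Vec ℝ n → ℝ) (1S : Vec ℝ n)
                      (ι : Vec ℝ n → Vec ℝ n) where

    _,_⟩S : Vec ℝ n → Vec ℝ n → ℝ
    _,_⟩S = polar _+ᵥ_ qS

    J : Set
    J = ℝ × Vec ℝ n

    Jops : VecOps
    Jops = record
      { Carrier = J
      ; _⊕_ = λ { (β , t) (β' , t') → (β + β' , t +ᵥ t') }
      ; _⊙_ = λ { c (β , t) → (c * β , c ·ᵥ t) } }

    NJ : J → ℝ
    NJ (β , t) = β * qS t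

    #J : J → J
    #J (β , t) = (qS t , β ·ᵥ ι t)

    1J : J
    1J = (1# , 1S)

    formJ : J → J → ℝ
    formJ (β , t) (β' , t') = β * β' + (t , ι t' ⟩S)

    V : Set
    V = ℝ × Vec ℝ n × ℝ

    _+V_ : V → V → V
    (α , s , β) +V (α' , s' , β') = (α + α' , s +ᵥ s' , β + β')

    qV : V → ℝ
    qV (α , s , β) = α * β - qS s

    _,_⟩V : V → V → ℝ
    _,_⟩V = polar _+V_ qV

    -- V₂ ⊗ V, with e ⊗ x + f ⊗ y represented by the pair (x , y)
    V₂⊗V : Set
    V₂⊗V = V × V

    -- ⟨v⊗x, v'⊗x'⟩ = ⟨v,v'⟩ (x,x')_V extended bilinearly, ⟨e,f⟩ = 1 = -⟨f,e⟩, ⟨e,e⟩=⟨f,f⟩=0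
    sympV : V₂⊗V → V₂⊗V → ℝ
    sympV (x , y) (x' , y') = (x , y' ⟩V) - (y , x' ⟩V)

    QV : V₂⊗V → ℝ
    QV (x , y) = (x , y ⟩V) ² - 4# * qV x * qV y

    W : Set
    W = ℝ × J × J × ℝ

    sympW : W → W → ℝ
    sympW (a , b , c , d) (a' , b' , c' , d') =
      a * d' - formJ b c' + formJ c b' - d * a'

    qW : W → ℝ
    qW (a , b , c , d) =
      (a * d - formJ b c) ² + 4# * a * NJ c + 4# * d * NJ b - 4# * formJ (#J b) (#J c)

    φ : V₂⊗V → W
    φ ((α , s , β) , (γ , t , δ')) = (α , (γ , s) , (β , ι t) , δ')

-- The signature hypothesis is only used to write q_S(x) = B(x,x) for a symmetric
-- bilinear B, so that (,)_S = 2B is bilinear with (x,x)_S = 2 q_S(x). Splitting t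
-- along 1_S (where B(1_S,1_S) = 1) gives the closed formula ι(t) = (t,1_S)_S 1_S - t,
-- from which ι is an isometric, self-adjoint involution of (,)_S. With these
-- facts every axiom of the cubic norm structure, and each of the two comparisons
-- of forms under the identification, becomes a polynomial identity in the scalar
-- coordinates and the values q_S(s), q_S(t), (s,t)_S, which the ring solver checks.

module Submission where

open import Algebra.Bundles using (CommutativeRing)
open import Algebra.Solver.Ring.AlmostCommutativeRing using (_-Raw-AlmostCommutative⟶_; fromCommutativeRing)
import Data.Integer as ℤ
import Data.Integer.Properties as ℤ
open import Data.Maybe using (Maybe; just; nothing)
open import Data.Nat as ℕ using (ℕ; zero; suc)
import Data.Nat.Properties as ℕ
import Data.Sign as Sign
import Relation.Binary.PropositionalEquality as ≡
open import Relation.Nullary using (yes; no)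

-- ℤ maps homomorphically into every commutative ring, so the ring solver can be
-- instantiated with integer coefficients over any of them.
module IntegerCoefficients {c ℓ} (CR : CommutativeRing c ℓ) where
  open CommutativeRing CR
  open import Algebra.Properties.Ring ring using (-‿distribˡ-*; -‿distribʳ-*; -‿involutive; -0#≈0#)
  open import Algebra.Properties.AbelianGroup +-abelianGroup using (⁻¹-∙-comm; xyx⁻¹≈y)
  open import Algebra.Properties.Semiring.Mult.TCOptimised semiring using (1+×; ×-homo-+; ×1-homo-*) renaming (_×_ to _×′_)
  open import Relation.Binary.Reasoning.Setoid setoid

  ⟦_⟧ℤ : ℤ.ℤ → Carrier
  ⟦ ℤ.+ n ⟧ℤ = n ×′ 1#
  ⟦ ℤ.-[1+ n ] ⟧ℤ = - (suc n ×′ 1#)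

  private
    x+y-[x+z]≈y-z : ∀ x y z → (x + y) - (x + z) ≈ y - z
    x+y-[x+z]≈y-z x y z = begin
      (x + y) + - (x + z)    ≈⟨ +-congˡ (⁻¹-∙-comm x z) ⟨
      (x + y) + (- x + - z)  ≈⟨ +-assoc (x + y) (- x) (- z) ⟨
      (x + y) + - x + - z    ≈⟨ +-congʳ (xyx⁻¹≈y x y) ⟩
      y + - z                ∎

    ⟦⊖⟧ : ∀ m n → ⟦ m ℤ.⊖ n ⟧ℤ ≈ m ×′ 1# - n ×′ 1#
    ⟦⊖⟧ zero    zero    = sym (-‿inverseʳ 0#)
    ⟦⊖⟧ zero    (suc n) = sym (+-identityˡ _)
    ⟦⊖⟧ (suc m) zero    = sym (trans (+-congˡ -0#≈0#) (+-identityʳ _))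
    ⟦⊖⟧ (suc m) (suc n) = begin
      ⟦ suc m ℤ.⊖ suc n ⟧ℤ             ≡⟨ ≡.cong ⟦_⟧ℤ (ℤ.[1+m]⊖[1+n]≡m⊖n m n) ⟩
      ⟦ m ℤ.⊖ n ⟧ℤ                     ≈⟨ ⟦⊖⟧ m n ⟩
      m ×′ 1# - n ×′ 1#                ≈⟨ x+y-[x+z]≈y-z 1# (m ×′ 1#) (n ×′ 1#) ⟨
      (1# + m ×′ 1#) - (1# + n ×′ 1#)  ≈⟨ +-cong (1+× m 1#) (-‿cong (1+× n 1#)) ⟨
      suc m ×′ 1# - suc n ×′ 1#        ∎

    ⟦+◃⟧ : ∀ n → ⟦ Sign.+ ℤ.◃ n ⟧ℤ ≈ n ×′ 1#
    ⟦+◃⟧ zero    = refl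
    ⟦+◃⟧ (suc n) = refl

    ⟦-◃⟧ : ∀ n → ⟦ Sign.- ℤ.◃ n ⟧ℤ ≈ - (n ×′ 1#)
    ⟦-◃⟧ zero    = sym -0#≈0#
    ⟦-◃⟧ (suc n) = refl

    ⟦-⟧ : ∀ i → ⟦ ℤ.- i ⟧ℤ ≈ - ⟦ i ⟧ℤ
    ⟦-⟧ (ℤ.+ zero)   = sym -0#≈0#
    ⟦-⟧ (ℤ.+ suc n)  = refl
    ⟦-⟧ ℤ.-[1+ n ]   = sym (-‿involutive _)

    ⟦+⟧ : ∀ i j → ⟦ i ℤ.+ j ⟧ℤ ≈ ⟦ i ⟧ℤ + ⟦ j ⟧ℤ
    ⟦+⟧ ℤ.-[1+ m ] ℤ.-[1+ n ] = begin
      - (suc (suc (m ℕ.+ n)) ×′ 1#)      ≡⟨ ≡.cong (λ k → - (suc k ×′ 1#)) (ℕ.+-suc m n) ⟨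
      - ((suc m ℕ.+ suc n) ×′ 1#)        ≈⟨ -‿cong (×-homo-+ 1# (suc m) (suc n)) ⟩
      - (suc m ×′ 1# + suc n ×′ 1#)      ≈⟨ ⁻¹-∙-comm _ _ ⟨
      - (suc m ×′ 1#) + - (suc n ×′ 1#)  ∎
    ⟦+⟧ ℤ.-[1+ m ] (ℤ.+ n)    = trans (⟦⊖⟧ n (suc m)) (+-comm _ _)
    ⟦+⟧ (ℤ.+ m)    ℤ.-[1+ n ] = ⟦⊖⟧ m (suc n)
    ⟦+⟧ (ℤ.+ m)    (ℤ.+ n)    = ×-homo-+ 1# m n

    ⟦*⟧ : ∀ i j → ⟦ i ℤ.* j ⟧ℤ ≈ ⟦ i ⟧ℤ * ⟦ j ⟧ℤ
    ⟦*⟧ (ℤ.+ m) (ℤ.+ n) = trans (⟦+◃⟧ (m ℕ.* n)) (×1-homo-* m n)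
    ⟦*⟧ (ℤ.+ m) ℤ.-[1+ n ] = begin
      ⟦ Sign.- ℤ.◃ (m ℕ.* suc n) ⟧ℤ  ≈⟨ ⟦-◃⟧ (m ℕ.* suc n) ⟩
      - ((m ℕ.* suc n) ×′ 1#)        ≈⟨ -‿cong (×1-homo-* m (suc n)) ⟩
      - (m ×′ 1# * (suc n ×′ 1#))    ≈⟨ -‿distribʳ-* _ _ ⟩
      m ×′ 1# * - (suc n ×′ 1#)      ∎
    ⟦*⟧ ℤ.-[1+ m ] (ℤ.+ n) = begin
      ⟦ Sign.- ℤ.◃ (suc m ℕ.* n) ⟧ℤ  ≈⟨ ⟦-◃⟧ (suc m ℕ.* n) ⟩
      - ((suc m ℕ.* n) ×′ 1#)        ≈⟨ -‿cong (×1-homo-* (suc m) n) ⟩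
      - (suc m ×′ 1# * (n ×′ 1#))    ≈⟨ -‿distribˡ-* _ _ ⟩
      - (suc m ×′ 1#) * (n ×′ 1#)    ∎
    ⟦*⟧ ℤ.-[1+ m ] ℤ.-[1+ n ] = begin
      (suc m ℕ.* suc n) ×′ 1#              ≈⟨ ×1-homo-* (suc m) (suc n) ⟩
      suc m ×′ 1# * (suc n ×′ 1#)          ≈⟨ -‿involutive _ ⟨
      - - (suc m ×′ 1# * (suc n ×′ 1#))    ≈⟨ -‿cong (-‿distribˡ-* _ _) ⟩
      - (- (suc m ×′ 1#) * (suc n ×′ 1#))  ≈⟨ -‿distribʳ-* _ _ ⟩
      - (suc m ×′ 1#) * - (suc n ×′ 1#)    ∎

    ℤ-homomorphism : ℤ.+-*-rawRing -Raw-AlmostCommutative⟶ fromCommutativeRing CR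
    ℤ-homomorphism = record
      { ⟦_⟧ = ⟦_⟧ℤ ; +-homo = ⟦+⟧ ; *-homo = ⟦*⟧ ; -‿homo = ⟦-⟧ ; 0-homo = refl ; 1-homo = refl }

    ⟦≟⟧ : ∀ i j → Maybe (⟦ i ⟧ℤ ≈ ⟦ j ⟧ℤ)
    ⟦≟⟧ i j with i ℤ.≟ j
    ... | yes ≡.refl = just refl
    ... | no _       = nothing

  open import Algebra.Solver.Ring ℤ.+-*-rawRing (fromCommutativeRing CR) ℤ-homomorphism ⟦≟⟧ public

open import Defs
open import Data.Fin using (Fin; zero; suc)
open import Data.Vec using (Vec; []; _∷_; lookup)
open import Data.Vec.Properties using (lookup∘tabulate; lookup-zipWith; lookup-map; map-cong; map-∘; map-id)
open import Data.Vec.Relation.Binary.Pointwise.Extensional using (ext; Pointwise-≡⇒≡)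
open import Data.Product using (∃; _×_; _,_; proj₁; proj₂)
open import Function using (_∘_)
open import Level using (0ℓ)
open import Relation.Binary.PropositionalEquality using (_≡_; refl; sym; trans; cong; cong₂; module ≡-Reasoning)

module _ (R : RealField) where
  open WithReals R
  open ≡-Reasoning

  ℝ-commutativeRing : CommutativeRing 0ℓ 0ℓ
  ℝ-commutativeRing = record { isCommutativeRing = isCommutativeRing }

  open CommutativeRing ℝ-commutativeRing
    using (+-comm; *-comm; *-assoc; distribˡ; distribʳ; *-identityˡ; *-identityʳ; zeroˡ; zeroʳ; +-identityˡ; +-identityʳ;
           semiring; +-commutativeSemigroup; *-commutativeSemigroup)
  open import Algebra.Properties.CommutativeSemigroup +-commutativeSemigroup using (interchange)
  open import Algebra.Properties.CommutativeSemigroup *-commutativeSemigroup using (x∙yz≈y∙xz)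
  open import Algebra.Properties.Semiring.Sum semiring
    using (sum; sum-syntax; sum-cong-≗; ∑-comm; ∑-distrib-+; *-distribˡ-sum; *-distribʳ-sum)
  open IntegerCoefficients ℝ-commutativeRing
    using (solve; _:=_; Polynomial; con; _:+_; _:*_; _:-_; :-_)

  -- Since 1 ×′ x reduces to x, these evaluate definitionally to 1#, 2#, 4# and 6#.
  :1 :2 :4 :6 : ∀ {k} → Polynomial k
  :1 = con (ℤ.+ 1)
  :2 = :1 :+ :1
  :4 = :2 :+ :2
  :6 = :4 :+ :2

  ℝⁿ : ℕ → VecOps
  ℝⁿ n = record { Carrier = Vec ℝ n ; _⊕_ = _+ᵥ_ ; _⊙_ = _·ᵥ_ }

  IsLinear : ∀ {m n} → (Vec ℝ m → Vec ℝ n) → Set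
  IsLinear L = (∀ x y → L (x +ᵥ y) ≡ L x +ᵥ L y) × (∀ c x → L (c ·ᵥ x) ≡ c ·ᵥ L x)

  IsQuadraticForm : ∀ {n} → (Vec ℝ n → ℝ) → Set
  IsQuadraticForm {n} q = ∃ λ B → IsSymBilinearForm (ℝⁿ n) B × (∀ x → q x ≡ B x x)

  ·ᵥ-distribʳ : ∀ {n} a b (v : Vec ℝ n) → (a + b) ·ᵥ v ≡ a ·ᵥ v +ᵥ b ·ᵥ v
  ·ᵥ-distribʳ a b []      = refl
  ·ᵥ-distribʳ a b (x ∷ v) = cong₂ _∷_ (distribʳ x a b) (·ᵥ-distribʳ a b v)

  ·ᵥ-distribˡ : ∀ {n} a (u v : Vec ℝ n) → a ·ᵥ (u +ᵥ v) ≡ a ·ᵥ u +ᵥ a ·ᵥ v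
  ·ᵥ-distribˡ a []      []      = refl
  ·ᵥ-distribˡ a (x ∷ u) (y ∷ v) = cong₂ _∷_ (distribˡ a x y) (·ᵥ-distribˡ a u v)

  *-·ᵥ-assoc : ∀ {n} a b (v : Vec ℝ n) → (a * b) ·ᵥ v ≡ a ·ᵥ (b ·ᵥ v)
  *-·ᵥ-assoc a b v = trans (map-cong (*-assoc a b) v) (map-∘ (a *_) (b *_) v)

  ·ᵥ-comm : ∀ {n} a b (v : Vec ℝ n) → a ·ᵥ (b ·ᵥ v) ≡ b ·ᵥ (a ·ᵥ v)
  ·ᵥ-comm a b v = begin
    a ·ᵥ (b ·ᵥ v)   ≡⟨ *-·ᵥ-assoc a b v ⟨
    (a * b) ·ᵥ v    ≡⟨ cong (_·ᵥ v) (*-comm a b) ⟩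
    (b * a) ·ᵥ v    ≡⟨ *-·ᵥ-assoc b a v ⟩
    b ·ᵥ (a ·ᵥ v)   ∎

  ·ᵥ-identityˡ : ∀ {n} (v : Vec ℝ n) → 1# ·ᵥ v ≡ v
  ·ᵥ-identityˡ v = trans (map-cong *-identityˡ v) (map-id v)

  ≡-by-coordinates : ∀ {n} {u v : Vec ℝ n} → (∀ i → lookup u i ≡ lookup v i) → u ≡ v
  ≡-by-coordinates u≗v = Pointwise-≡⇒≡ (ext u≗v)

  sumF≡sum : ∀ {m} (f : Fin m → ℝ) → sumF f ≡ sum f
  sumF≡sum {zero}  f = refl
  sumF≡sum {suc m} f = cong (f zero +_) (sumF≡sum (f ∘ suc))

  sum-δ : ∀ {m} (i : Fin m) (f : Fin m → ℝ) → ∑[ k < m ] (δ i k * f k) ≡ f i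
  sum-δ {suc m} zero    f = begin
    1# * f zero + ∑[ k < m ] (0# * f (suc k))  ≡⟨ cong (1# * f zero +_) (*-distribˡ-sum 0# (f ∘ suc)) ⟨
    1# * f zero + 0# * sum (f ∘ suc)           ≡⟨ cong₂ _+_ (*-identityˡ _) (zeroˡ _) ⟩
    f zero + 0#                                ≡⟨ +-identityʳ (f zero) ⟩
    f zero                                     ∎
  sum-δ {suc m} (suc i) f = begin
    0# * f zero + ∑[ k < m ] (δ i k * f (suc k))  ≡⟨ cong (_+ ∑[ k < m ] (δ i k * f (suc k))) (zeroˡ (f zero)) ⟩
    0# + ∑[ k < m ] (δ i k * f (suc k))           ≡⟨ +-identityˡ _ ⟩
    ∑[ k < m ] (δ i k * f (suc k))                ≡⟨ sum-δ i (f ∘ suc) ⟩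
    f (suc i)                                     ∎

  lookup-$ₘ : ∀ {n} (M : Mat n) x i → lookup (M $ₘ x) i ≡ ∑[ j < n ] (M i j * lookup x j)
  lookup-$ₘ M x i = trans (lookup∘tabulate _ i) (sumF≡sum (λ j → M i j * lookup x j))

  $ₘ-linear : ∀ {n} (M : Mat n) → IsLinear (M $ₘ_)
  $ₘ-linear {n} M = additive , homogeneous
    where
    additive : ∀ x y → M $ₘ (x +ᵥ y) ≡ M $ₘ x +ᵥ M $ₘ y
    additive x y = ≡-by-coordinates λ i → begin
      lookup (M $ₘ (x +ᵥ y)) i
        ≡⟨ lookup-$ₘ M (x +ᵥ y) i ⟩
      ∑[ j < n ] (M i j * lookup (x +ᵥ y) j)
        ≡⟨ sum-cong-≗ (λ j → trans (cong (M i j *_) (lookup-zipWith _+_ j x y)) (distribˡ _ _ _)) ⟩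
      ∑[ j < n ] (M i j * lookup x j + M i j * lookup y j)
        ≡⟨ ∑-distrib-+ (λ j → M i j * lookup x j) (λ j → M i j * lookup y j) ⟩
      ∑[ j < n ] (M i j * lookup x j) + ∑[ j < n ] (M i j * lookup y j)
        ≡⟨ cong₂ _+_ (lookup-$ₘ M x i) (lookup-$ₘ M y i) ⟨
      lookup (M $ₘ x) i + lookup (M $ₘ y) i
        ≡⟨ lookup-zipWith _+_ i (M $ₘ x) (M $ₘ y) ⟨
      lookup (M $ₘ x +ᵥ M $ₘ y) i
        ∎
    homogeneous : ∀ c x → M $ₘ (c ·ᵥ x) ≡ c ·ᵥ M $ₘ x
    homogeneous c x = ≡-by-coordinates λ i → begin
      lookup (M $ₘ (c ·ᵥ x)) i
        ≡⟨ lookup-$ₘ M (c ·ᵥ x) i ⟩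
      ∑[ j < n ] (M i j * lookup (c ·ᵥ x) j)
        ≡⟨ sum-cong-≗ (λ j → trans (cong (M i j *_) (lookup-map j (c *_) x)) (x∙yz≈y∙xz (M i j) c (lookup x j))) ⟩
      ∑[ j < n ] (c * (M i j * lookup x j))
        ≡⟨ *-distribˡ-sum c (λ j → M i j * lookup x j) ⟨
      c * ∑[ j < n ] (M i j * lookup x j)
        ≡⟨ cong (c *_) (lookup-$ₘ M x i) ⟨
      c * lookup (M $ₘ x) i
        ≡⟨ lookup-map i (c *_) (M $ₘ x) ⟨
      lookup (c ·ᵥ M $ₘ x) i
        ∎

  $ₘ-∙ₘ : ∀ {n} (P Q : Mat n) y → P $ₘ (Q $ₘ y) ≡ (P ∙ₘ Q) $ₘ y
  $ₘ-∙ₘ {n} P Q y = ≡-by-coordinates λ i → begin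
    lookup (P $ₘ (Q $ₘ y)) i
      ≡⟨ lookup-$ₘ P (Q $ₘ y) i ⟩
    ∑[ j < n ] (P i j * lookup (Q $ₘ y) j)
      ≡⟨ sum-cong-≗ (λ j → cong (P i j *_) (lookup-$ₘ Q y j)) ⟩
    ∑[ j < n ] (P i j * ∑[ k < n ] (Q j k * lookup y k))
      ≡⟨ sum-cong-≗ (λ j → *-distribˡ-sum (P i j) (λ k → Q j k * lookup y k)) ⟩
    ∑[ j < n ] ∑[ k < n ] (P i j * (Q j k * lookup y k))
      ≡⟨ ∑-comm (λ j k → P i j * (Q j k * lookup y k)) ⟩
    ∑[ k < n ] ∑[ j < n ] (P i j * (Q j k * lookup y k))
      ≡⟨ sum-cong-≗ (λ k → sum-cong-≗ (λ j → *-assoc (P i j) (Q j k) (lookup y k))) ⟨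
    ∑[ k < n ] ∑[ j < n ] (P i j * Q j k * lookup y k)
      ≡⟨ sum-cong-≗ (λ k → *-distribʳ-sum (lookup y k) (λ j → P i j * Q j k)) ⟨
    ∑[ k < n ] (∑[ j < n ] (P i j * Q j k) * lookup y k)
      ≡⟨ sum-cong-≗ (λ k → cong (_* lookup y k) (sumF≡sum (λ j → P i j * Q j k))) ⟨
    ∑[ k < n ] ((P ∙ₘ Q) i k * lookup y k)
      ≡⟨ lookup-$ₘ (P ∙ₘ Q) y i ⟨
    lookup ((P ∙ₘ Q) $ₘ y) i
      ∎

  $ₘ-identity : ∀ {n} (I : Mat n) → (∀ i k → I i k ≡ δ i k) → ∀ y → I $ₘ y ≡ y
  $ₘ-identity {n} I I≡δ y = ≡-by-coordinates λ i → begin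
    lookup (I $ₘ y) i                 ≡⟨ lookup-$ₘ I y i ⟩
    ∑[ k < n ] (I i k * lookup y k)   ≡⟨ sum-cong-≗ (λ k → cong (_* lookup y k) (I≡δ i k)) ⟩
    ∑[ k < n ] (δ i k * lookup y k)   ≡⟨ sum-δ i (lookup y) ⟩
    lookup y i                        ∎

  euclid : ∀ {n} → Vec ℝ n → Vec ℝ n → ℝ
  euclid []      []      = 0#
  euclid (a ∷ x) (b ∷ y) = a * b + euclid x y

  euclid-sym : ∀ {n} (x y : Vec ℝ n) → euclid x y ≡ euclid y x
  euclid-sym []      []      = refl
  euclid-sym (a ∷ x) (b ∷ y) = cong₂ _+_ (*-comm a b) (euclid-sym x y)

  euclid-+ˡ : ∀ {n} (x x' y : Vec ℝ n) → euclid (x +ᵥ x') y ≡ euclid x y + euclid x' y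
  euclid-+ˡ []      []        []      = sym (+-identityʳ 0#)
  euclid-+ˡ (a ∷ x) (a' ∷ x') (b ∷ y) = trans (cong ((a + a') * b +_) (euclid-+ˡ x x' y))
    (solve 5 (λ a a' b e e' → (a :+ a') :* b :+ (e :+ e') := a :* b :+ e :+ (a' :* b :+ e'))
           refl a a' b (euclid x y) (euclid x' y))

  euclid-·ˡ : ∀ {n} c (x y : Vec ℝ n) → euclid (c ·ᵥ x) y ≡ c * euclid x y
  euclid-·ˡ c []      []      = sym (zeroʳ c)
  euclid-·ˡ c (a ∷ x) (b ∷ y) = trans (cong (c * a * b +_) (euclid-·ˡ c x y))
    (solve 4 (λ c a b e → c :* a :* b :+ c :* e := c :* (a :* b :+ e)) refl c a b (euclid x y))

  minkowski : ∀ {r} → Vec ℝ (suc r) → Vec ℝ (suc r) → ℝ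
  minkowski (a ∷ x) (b ∷ y) = a * b - euclid x y

  minkowski-isSymBilinear : ∀ {r} → IsSymBilinearForm (ℝⁿ (suc r)) minkowski
  minkowski-isSymBilinear = symmetric , additive , homogeneous
    where
    symmetric : ∀ {r} (x y : Vec ℝ (suc r)) → minkowski x y ≡ minkowski y x
    symmetric (a ∷ x) (b ∷ y) = cong₂ _-_ (*-comm a b) (euclid-sym x y)
    additive : ∀ {r} (x x' y : Vec ℝ (suc r)) → minkowski (x +ᵥ x') y ≡ minkowski x y + minkowski x' y
    additive (a ∷ x) (a' ∷ x') (b ∷ y) = trans (cong (λ e → (a + a') * b - e) (euclid-+ˡ x x' y))
      (solve 5 (λ a a' b e e' → (a :+ a') :* b :- (e :+ e') := (a :* b :- e) :+ (a' :* b :- e'))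
             refl a a' b (euclid x y) (euclid x' y))
    homogeneous : ∀ {r} c (x y : Vec ℝ (suc r)) → minkowski (c ·ᵥ x) y ≡ c * minkowski x y
    homogeneous c (a ∷ x) (b ∷ y) = trans (cong (λ e → c * a * b - e) (euclid-·ˡ c x y))
      (solve 4 (λ c a b e → c :* a :* b :- c :* e := c :* (a :* b :- e)) refl c a b (euclid x y))

  minkowski-diagonal : ∀ {r} (x : Vec ℝ (suc r)) →
                       (lookup x zero) ² - sumF (λ i → (lookup x (suc i)) ²) ≡ minkowski x x
  minkowski-diagonal (a ∷ x) = cong (λ e → a ² - e) (sum-squares x)
    where
    sum-squares : ∀ {n} (x : Vec ℝ n) → sumF (λ i → (lookup x i) ²) ≡ euclid x x
    sum-squares []      = refl
    sum-squares (b ∷ x) = cong (b ² +_) (sum-squares x)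

  isSymBilinear-∘-linear : ∀ {m n} {B : Vec ℝ n → Vec ℝ n → ℝ} {L : Vec ℝ m → Vec ℝ n} →
                           IsSymBilinearForm (ℝⁿ n) B → IsLinear L →
                           IsSymBilinearForm (ℝⁿ m) (λ x y → B (L x) (L y))
  isSymBilinear-∘-linear {B = B} {L} (B-sym , B-+ , B-·) (L-+ , L-·) =
    (λ x y → B-sym (L x) (L y)) ,
    (λ x x' y → trans (cong (λ z → B z (L y)) (L-+ x x')) (B-+ (L x) (L x') (L y))) ,
    (λ c x y → trans (cong (λ z → B z (L y)) (L-· c x)) (B-· c (L x) (L y)))

  signature⇒isQuadraticForm : ∀ {r} {q : Vec ℝ (suc r) → ℝ} → HasSignature1 r q → IsQuadraticForm q
  signature⇒isQuadraticForm {r} {q} (P , P⁻¹ , PP⁻¹≡I , _ , q∘P≡diagonal) =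
    B , isSymBilinear-∘-linear minkowski-isSymBilinear ($ₘ-linear P⁻¹) , q≡B
    where
    B : Vec ℝ (suc r) → Vec ℝ (suc r) → ℝ
    B x y = minkowski (P⁻¹ $ₘ x) (P⁻¹ $ₘ y)
    q≡B : ∀ x → q x ≡ B x x
    q≡B x = begin
      q x                          ≡⟨ cong q (trans ($ₘ-∙ₘ P P⁻¹ x) ($ₘ-identity (P ∙ₘ P⁻¹) PP⁻¹≡I x)) ⟨
      q (P $ₘ y)                   ≡⟨ q∘P≡diagonal y ⟩
      (lookup y zero) ² - sumF (λ i → (lookup y (suc i)) ²)
                                   ≡⟨ minkowski-diagonal y ⟩
      minkowski y y                ∎
      where
      y : Vec ℝ (suc r)
      y = P⁻¹ $ₘ x

  module QuadraticForm {n} {q : Vec ℝ n → ℝ} (isQuad : IsQuadraticForm q) where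

    B : Vec ℝ n → Vec ℝ n → ℝ
    B = proj₁ isQuad

    B-sym : ∀ x y → B x y ≡ B y x
    B-sym = proj₁ (proj₁ (proj₂ isQuad))

    B-+ˡ : ∀ x x' y → B (x +ᵥ x') y ≡ B x y + B x' y
    B-+ˡ = proj₁ (proj₂ (proj₁ (proj₂ isQuad)))

    B-·ˡ : ∀ c x y → B (c ·ᵥ x) y ≡ c * B x y
    B-·ˡ = proj₂ (proj₂ (proj₁ (proj₂ isQuad)))

    q≡B : ∀ x → q x ≡ B x x
    q≡B = proj₂ (proj₂ isQuad)

    B-+ʳ : ∀ x y y' → B x (y +ᵥ y') ≡ B x y + B x y'
    B-+ʳ x y y' = begin
      B x (y +ᵥ y')     ≡⟨ B-sym x (y +ᵥ y') ⟩
      B (y +ᵥ y') x     ≡⟨ B-+ˡ y y' x ⟩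
      B y x + B y' x    ≡⟨ cong₂ _+_ (B-sym y x) (B-sym y' x) ⟩
      B x y + B x y'    ∎

    B-·ʳ : ∀ c x y → B x (c ·ᵥ y) ≡ c * B x y
    B-·ʳ c x y = begin
      B x (c ·ᵥ y)   ≡⟨ B-sym x (c ·ᵥ y) ⟩
      B (c ·ᵥ y) x   ≡⟨ B-·ˡ c y x ⟩
      c * B y x      ≡⟨ cong (c *_) (B-sym y x) ⟩
      c * B x y      ∎

    ⟪_,_⟫ : Vec ℝ n → Vec ℝ n → ℝ
    ⟪_,_⟫ = polar _+ᵥ_ q

    q-+ : ∀ x y → q (x +ᵥ y) ≡ q x + ⟪ x , y ⟫ + q y
    q-+ x y = solve 3 (λ s a b → s := a :+ (s :- a :- b) :+ b) refl (q (x +ᵥ y)) (q x) (q y)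

    ⟪⟫≡2B : ∀ x y → ⟪ x , y ⟫ ≡ 2# * B x y
    ⟪⟫≡2B x y = begin
      q (x +ᵥ y) - q x - q y
        ≡⟨ cong₂ _-_ (cong₂ _-_ (q≡B (x +ᵥ y)) (q≡B x)) (q≡B y) ⟩
      B (x +ᵥ y) (x +ᵥ y) - B x x - B y y
        ≡⟨ cong (λ b → b - B x x - B y y) (B-+ˡ x y (x +ᵥ y)) ⟩
      B x (x +ᵥ y) + B y (x +ᵥ y) - B x x - B y y
        ≡⟨ cong₂ (λ b b' → b + b' - B x x - B y y) (B-+ʳ x x y) (trans (B-+ʳ y x y) (cong (_+ B y y) (B-sym y x))) ⟩
      B x x + B x y + (B x y + B y y) - B x x - B y y
        ≡⟨ solve 3 (λ a b c → a :+ b :+ (b :+ c) :- a :- c := :2 :* b) refl (B x x) (B x y) (B y y) ⟩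
      2# * B x y
        ∎

    ⟪⟫-sym : ∀ x y → ⟪ x , y ⟫ ≡ ⟪ y , x ⟫
    ⟪⟫-sym x y = begin
      ⟪ x , y ⟫     ≡⟨ ⟪⟫≡2B x y ⟩
      2# * B x y    ≡⟨ cong (2# *_) (B-sym x y) ⟩
      2# * B y x    ≡⟨ ⟪⟫≡2B y x ⟨
      ⟪ y , x ⟫     ∎

    ⟪⟫-+ˡ : ∀ x x' y → ⟪ x +ᵥ x' , y ⟫ ≡ ⟪ x , y ⟫ + ⟪ x' , y ⟫
    ⟪⟫-+ˡ x x' y = begin
      ⟪ x +ᵥ x' , y ⟫                 ≡⟨ ⟪⟫≡2B (x +ᵥ x') y ⟩
      2# * B (x +ᵥ x') y              ≡⟨ cong (2# *_) (B-+ˡ x x' y) ⟩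
      2# * (B x y + B x' y)           ≡⟨ distribˡ 2# (B x y) (B x' y) ⟩
      2# * B x y + 2# * B x' y        ≡⟨ cong₂ _+_ (⟪⟫≡2B x y) (⟪⟫≡2B x' y) ⟨
      ⟪ x , y ⟫ + ⟪ x' , y ⟫          ∎

    ⟪⟫-·ˡ : ∀ c x y → ⟪ c ·ᵥ x , y ⟫ ≡ c * ⟪ x , y ⟫
    ⟪⟫-·ˡ c x y = begin
      ⟪ c ·ᵥ x , y ⟫       ≡⟨ ⟪⟫≡2B (c ·ᵥ x) y ⟩
      2# * B (c ·ᵥ x) y    ≡⟨ cong (2# *_) (B-·ˡ c x y) ⟩
      2# * (c * B x y)     ≡⟨ solve 2 (λ c b → :2 :* (c :* b) := c :* (:2 :* b)) refl c (B x y) ⟩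
      c * (2# * B x y)     ≡⟨ cong (c *_) (⟪⟫≡2B x y) ⟨
      c * ⟪ x , y ⟫        ∎

    ⟪⟫-·ʳ : ∀ c x y → ⟪ x , c ·ᵥ y ⟫ ≡ c * ⟪ x , y ⟫
    ⟪⟫-·ʳ c x y = begin
      ⟪ x , c ·ᵥ y ⟫   ≡⟨ ⟪⟫-sym x (c ·ᵥ y) ⟩
      ⟪ c ·ᵥ y , x ⟫   ≡⟨ ⟪⟫-·ˡ c y x ⟩
      c * ⟪ y , x ⟫    ≡⟨ cong (c *_) (⟪⟫-sym y x) ⟩
      c * ⟪ x , y ⟫    ∎

    ⟪⟫-diagonal : ∀ x → ⟪ x , x ⟫ ≡ 2# * q x
    ⟪⟫-diagonal x = trans (⟪⟫≡2B x x) (cong (2# *_) (sym (q≡B x)))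

    q-· : ∀ c x → q (c ·ᵥ x) ≡ c * c * q x
    q-· c x = begin
      q (c ·ᵥ x)             ≡⟨ q≡B (c ·ᵥ x) ⟩
      B (c ·ᵥ x) (c ·ᵥ x)    ≡⟨ B-·ˡ c x (c ·ᵥ x) ⟩
      c * B x (c ·ᵥ x)       ≡⟨ cong (c *_) (B-·ʳ c x x) ⟩
      c * (c * B x x)        ≡⟨ *-assoc c c (B x x) ⟨
      c * c * B x x          ≡⟨ cong (c * c *_) (q≡B x) ⟨
      c * c * q x            ∎

  module StdInvolution {n} {q : Vec ℝ n → ℝ} (isQuad : IsQuadraticForm q)
                       (1S : Vec ℝ n) (q1 : q 1S ≡ 1#)
                       (ι : Vec ℝ n → Vec ℝ n) (isStd : IsStdInvolution q 1S ι) where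
    open QuadraticForm isQuad public

    ι-+ : ∀ x y → ι (x +ᵥ y) ≡ ι x +ᵥ ι y
    ι-+ = proj₁ isStd

    ι-· : ∀ c x → ι (c ·ᵥ x) ≡ c ·ᵥ ι x
    ι-· = proj₁ (proj₂ isStd)

    ι-1 : ι 1S ≡ 1S
    ι-1 = proj₁ (proj₂ (proj₂ isStd))

    ι-⊥ : ∀ x → ⟪ x , 1S ⟫ ≡ 0# → ι x ≡ -ᵥ x
    ι-⊥ = proj₂ (proj₂ (proj₂ isStd))

    ⟪1,1⟫ : ⟪ 1S , 1S ⟫ ≡ 2#
    ⟪1,1⟫ = trans (⟪⟫-diagonal 1S) (trans (cong (2# *_) q1) (*-identityʳ 2#))

    -- t splits as u + B(t,1S)·1S with u ⟂ 1S, because B(1S,1S) = 1.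
    ι-formula : ∀ t → ι t ≡ ⟪ t , 1S ⟫ ·ᵥ 1S +ᵥ (- 1#) ·ᵥ t
    ι-formula t = begin
      ι t                                ≡⟨ cong ι (split a t 1S) ⟩
      ι (u +ᵥ a ·ᵥ 1S)                   ≡⟨ ι-+ u (a ·ᵥ 1S) ⟩
      ι u +ᵥ ι (a ·ᵥ 1S)                 ≡⟨ cong₂ _+ᵥ_ (ι-⊥ u u⊥1S) (trans (ι-· a 1S) (cong (a ·ᵥ_) ι-1)) ⟩
      -ᵥ u +ᵥ a ·ᵥ 1S                    ≡⟨ reflect a t 1S ⟩
      (2# * a) ·ᵥ 1S +ᵥ (- 1#) ·ᵥ t      ≡⟨ cong (λ c → c ·ᵥ 1S +ᵥ (- 1#) ·ᵥ t) (⟪⟫≡2B t 1S) ⟨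
      ⟪ t , 1S ⟫ ·ᵥ 1S +ᵥ (- 1#) ·ᵥ t    ∎
      where
      a : ℝ
      a = B t 1S
      u : Vec ℝ n
      u = t +ᵥ (- a) ·ᵥ 1S
      u⊥1S : ⟪ u , 1S ⟫ ≡ 0#
      u⊥1S = begin
        ⟪ t +ᵥ (- a) ·ᵥ 1S , 1S ⟫
          ≡⟨ ⟪⟫-+ˡ t ((- a) ·ᵥ 1S) 1S ⟩
        ⟪ t , 1S ⟫ + ⟪ (- a) ·ᵥ 1S , 1S ⟫
          ≡⟨ cong₂ _+_ (⟪⟫≡2B t 1S) (trans (⟪⟫-·ˡ (- a) 1S 1S) (cong ((- a) *_) ⟪1,1⟫)) ⟩
        2# * a + (- a) * 2#
          ≡⟨ solve 1 (λ a → :2 :* a :+ (:- a) :* :2 := con (ℤ.+ 0)) refl a ⟩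
        0#
          ∎
      split : ∀ {m} c (x o : Vec ℝ m) → x ≡ (x +ᵥ (- c) ·ᵥ o) +ᵥ c ·ᵥ o
      split c []      []      = refl
      split c (x ∷ v) (o ∷ w) =
        cong₂ _∷_ (solve 3 (λ c x o → x := (x :+ (:- c) :* o) :+ c :* o) refl c x o) (split c v w)
      reflect : ∀ {m} c (x o : Vec ℝ m) → -ᵥ (x +ᵥ (- c) ·ᵥ o) +ᵥ c ·ᵥ o ≡ (2# * c) ·ᵥ o +ᵥ (- 1#) ·ᵥ x
      reflect c []      []      = refl
      reflect c (x ∷ v) (o ∷ w) =
        cong₂ _∷_ (solve 3 (λ c x o → :- (x :+ (:- c) :* o) :+ c :* o := (:2 :* c) :* o :+ (:- :1) :* x) refl c x o)
                  (reflect c v w)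

    ⟪ι⟫ˡ : ∀ x y → ⟪ ι x , y ⟫ ≡ ⟪ x , 1S ⟫ * ⟪ y , 1S ⟫ - ⟪ x , y ⟫
    ⟪ι⟫ˡ x y = begin
      ⟪ ι x , y ⟫
        ≡⟨ cong ⟪_, y ⟫ (ι-formula x) ⟩
      ⟪ ⟪ x , 1S ⟫ ·ᵥ 1S +ᵥ (- 1#) ·ᵥ x , y ⟫
        ≡⟨ ⟪⟫-+ˡ _ _ y ⟩
      ⟪ ⟪ x , 1S ⟫ ·ᵥ 1S , y ⟫ + ⟪ (- 1#) ·ᵥ x , y ⟫
        ≡⟨ cong₂ _+_ (⟪⟫-·ˡ _ 1S y) (⟪⟫-·ˡ (- 1#) x y) ⟩
      ⟪ x , 1S ⟫ * ⟪ 1S , y ⟫ + (- 1#) * ⟪ x , y ⟫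
        ≡⟨ cong (λ z → ⟪ x , 1S ⟫ * z + (- 1#) * ⟪ x , y ⟫) (⟪⟫-sym 1S y) ⟩
      ⟪ x , 1S ⟫ * ⟪ y , 1S ⟫ + (- 1#) * ⟪ x , y ⟫
        ≡⟨ solve 3 (λ a b c → a :* b :+ (:- :1) :* c := a :* b :- c) refl ⟪ x , 1S ⟫ ⟪ y , 1S ⟫ ⟪ x , y ⟫ ⟩
      ⟪ x , 1S ⟫ * ⟪ y , 1S ⟫ - ⟪ x , y ⟫
        ∎

    ⟪ι⟫ʳ : ∀ x y → ⟪ x , ι y ⟫ ≡ ⟪ x , 1S ⟫ * ⟪ y , 1S ⟫ - ⟪ x , y ⟫
    ⟪ι⟫ʳ x y = begin
      ⟪ x , ι y ⟫                              ≡⟨ ⟪⟫-sym x (ι y) ⟩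
      ⟪ ι y , x ⟫                              ≡⟨ ⟪ι⟫ˡ y x ⟩
      ⟪ y , 1S ⟫ * ⟪ x , 1S ⟫ - ⟪ y , x ⟫      ≡⟨ cong₂ _-_ (*-comm _ _) (⟪⟫-sym y x) ⟩
      ⟪ x , 1S ⟫ * ⟪ y , 1S ⟫ - ⟪ x , y ⟫      ∎

    ⟪ι,1⟫ : ∀ x → ⟪ ι x , 1S ⟫ ≡ ⟪ x , 1S ⟫
    ⟪ι,1⟫ x = begin
      ⟪ ι x , 1S ⟫                           ≡⟨ ⟪ι⟫ˡ x 1S ⟩
      ⟪ x , 1S ⟫ * ⟪ 1S , 1S ⟫ - ⟪ x , 1S ⟫  ≡⟨ cong (λ z → ⟪ x , 1S ⟫ * z - ⟪ x , 1S ⟫) ⟪1,1⟫ ⟩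
      ⟪ x , 1S ⟫ * 2# - ⟪ x , 1S ⟫           ≡⟨ solve 1 (λ a → a :* :2 :- a := a) refl ⟪ x , 1S ⟫ ⟩
      ⟪ x , 1S ⟫                             ∎

    ι-involutive : ∀ x → ι (ι x) ≡ x
    ι-involutive x = begin
      ι (ι x)
        ≡⟨ ι-formula (ι x) ⟩
      ⟪ ι x , 1S ⟫ ·ᵥ 1S +ᵥ (- 1#) ·ᵥ ι x
        ≡⟨ cong₂ (λ c v → c ·ᵥ 1S +ᵥ (- 1#) ·ᵥ v) (⟪ι,1⟫ x) (ι-formula x) ⟩
      ⟪ x , 1S ⟫ ·ᵥ 1S +ᵥ (- 1#) ·ᵥ (⟪ x , 1S ⟫ ·ᵥ 1S +ᵥ (- 1#) ·ᵥ x)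
        ≡⟨ cancel ⟪ x , 1S ⟫ 1S x ⟩
      x
        ∎
      where
      cancel : ∀ {m} c (o x : Vec ℝ m) → c ·ᵥ o +ᵥ (- 1#) ·ᵥ (c ·ᵥ o +ᵥ (- 1#) ·ᵥ x) ≡ x
      cancel c []      []      = refl
      cancel c (o ∷ w) (x ∷ v) =
        cong₂ _∷_ (solve 3 (λ c o x → c :* o :+ (:- :1) :* (c :* o :+ (:- :1) :* x) := x) refl c o x) (cancel c w v)

    ⟪ι,ι⟫ : ∀ x y → ⟪ ι x , ι y ⟫ ≡ ⟪ x , y ⟫
    ⟪ι,ι⟫ x y = begin
      ⟪ ι x , ι y ⟫
        ≡⟨ ⟪ι⟫ˡ x (ι y) ⟩
      ⟪ x , 1S ⟫ * ⟪ ι y , 1S ⟫ - ⟪ x , ι y ⟫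
        ≡⟨ cong₂ (λ a b → ⟪ x , 1S ⟫ * a - b) (⟪ι,1⟫ y) (⟪ι⟫ʳ x y) ⟩
      ⟪ x , 1S ⟫ * ⟪ y , 1S ⟫ - (⟪ x , 1S ⟫ * ⟪ y , 1S ⟫ - ⟪ x , y ⟫)
        ≡⟨ solve 2 (λ p c → p :- (p :- c) := c) refl (⟪ x , 1S ⟫ * ⟪ y , 1S ⟫) ⟪ x , y ⟫ ⟩
      ⟪ x , y ⟫
        ∎

    q-ι : ∀ x → q (ι x) ≡ q x
    q-ι x = begin
      q (ι x)
        ≡⟨ cong q (ι-formula x) ⟩
      q (a ·ᵥ 1S +ᵥ (- 1#) ·ᵥ x)
        ≡⟨ q-+ (a ·ᵥ 1S) ((- 1#) ·ᵥ x) ⟩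
      q (a ·ᵥ 1S) + ⟪ a ·ᵥ 1S , (- 1#) ·ᵥ x ⟫ + q ((- 1#) ·ᵥ x)
        ≡⟨ cong₂ _+_ (cong₂ _+_ (q-· a 1S) (trans (⟪⟫-·ˡ a 1S _) (cong (a *_) (⟪⟫-·ʳ (- 1#) 1S x)))) (q-· (- 1#) x) ⟩
      a * a * q 1S + a * ((- 1#) * ⟪ 1S , x ⟫) + (- 1#) * (- 1#) * q x
        ≡⟨ cong₂ (λ b c → a * a * b + a * ((- 1#) * c) + (- 1#) * (- 1#) * q x) q1 (⟪⟫-sym 1S x) ⟩
      a * a * 1# + a * ((- 1#) * a) + (- 1#) * (- 1#) * q x
        ≡⟨ solve 2 (λ a b → a :* a :* :1 :+ a :* ((:- :1) :* a) :+ (:- :1) :* (:- :1) :* b := b) refl a (q x) ⟩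
      q x
        ∎
      where
      a : ℝ
      a = ⟪ x , 1S ⟫

    ⟪⟫-ι-sym : ∀ x y → ⟪ x , ι y ⟫ ≡ ⟪ y , ι x ⟫
    ⟪⟫-ι-sym x y = begin
      ⟪ x , ι y ⟫                            ≡⟨ ⟪ι⟫ʳ x y ⟩
      ⟪ x , 1S ⟫ * ⟪ y , 1S ⟫ - ⟪ x , y ⟫    ≡⟨ cong₂ _-_ (*-comm _ _) (⟪⟫-sym x y) ⟩
      ⟪ y , 1S ⟫ * ⟪ x , 1S ⟫ - ⟪ y , x ⟫    ≡⟨ ⟪ι⟫ʳ y x ⟨
      ⟪ y , ι x ⟫                            ∎

    ⟪1,ι⟫ : ∀ x → ⟪ 1S , ι x ⟫ ≡ ⟪ x , 1S ⟫
    ⟪1,ι⟫ x = trans (⟪⟫-ι-sym 1S x) (cong ⟪ x ,_⟫ ι-1)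

  module _ {n} {q : Vec ℝ n → ℝ} (isQuad : IsQuadraticForm q)
           (1S : Vec ℝ n) (q1 : q 1S ≡ 1#)
           (ι : Vec ℝ n → Vec ℝ n) (isStd : IsStdInvolution q 1S ι) where
    open StdInvolution isQuad 1S q1 ι isStd
    open Construction q 1S ι
    open VecOps Jops using () renaming (_⊕_ to _⊕J_; _⊙_ to _⊙J_)

    #J-isQuadraticMap : IsQuadraticMap Jops #J
    #J-isQuadraticMap = B# , (B#-+ˡ , B#-·ˡ , B#-+ʳ , B#-·ʳ) , #J≡B#
      where
      B# : J → J → J
      B# (β , t) (β' , t') = (B t t' , β ·ᵥ ι t')
      B#-+ˡ : ∀ x x' y → B# (x ⊕J x') y ≡ B# x y ⊕J B# x' y
      B#-+ˡ (β , t) (β'' , t'') (β' , t') = cong₂ _,_ (B-+ˡ t t'' t') (·ᵥ-distribʳ β β'' (ι t'))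
      B#-·ˡ : ∀ c x y → B# (c ⊙J x) y ≡ c ⊙J B# x y
      B#-·ˡ c (β , t) (β' , t') = cong₂ _,_ (B-·ˡ c t t') (*-·ᵥ-assoc c β (ι t'))
      B#-+ʳ : ∀ x y y' → B# x (y ⊕J y') ≡ B# x y ⊕J B# x y'
      B#-+ʳ (β , t) (β' , t') (β'' , t'') =
        cong₂ _,_ (B-+ʳ t t' t'') (trans (cong (β ·ᵥ_) (ι-+ t' t'')) (·ᵥ-distribˡ β (ι t') (ι t'')))
      B#-·ʳ : ∀ c x y → B# x (c ⊙J y) ≡ c ⊙J B# x y
      B#-·ʳ c (β , t) (β' , t') =
        cong₂ _,_ (B-·ʳ c t t') (trans (cong (β ·ᵥ_) (ι-· c t')) (·ᵥ-comm β c (ι t')))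
      #J≡B# : ∀ x → #J x ≡ B# x x
      #J≡B# (β , t) = cong (_, β ·ᵥ ι t) (q≡B t)

    formJ-isSymBilinear : IsSymBilinearForm Jops formJ
    formJ-isSymBilinear = symmetric , additive , homogeneous
      where
      symmetric : ∀ x y → formJ x y ≡ formJ y x
      symmetric (β , t) (β' , t') = cong₂ _+_ (*-comm β β') (⟪⟫-ι-sym t t')
      additive : ∀ x x' y → formJ (x ⊕J x') y ≡ formJ x y + formJ x' y
      additive (β , t) (β₀ , t₀) (β' , t') =
        trans (cong₂ _+_ (distribʳ β' β β₀) (⟪⟫-+ˡ t t₀ (ι t')))
              (interchange (β * β') (β₀ * β') ⟪ t , ι t' ⟫ ⟪ t₀ , ι t' ⟫)
      homogeneous : ∀ c x y → formJ (c ⊙J x) y ≡ c * formJ x y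
      homogeneous c (β , t) (β' , t') =
        trans (cong₂ _+_ (*-assoc c β β') (⟪⟫-·ˡ c t (ι t'))) (sym (distribˡ c (β * β') ⟪ t , ι t' ⟫))

    polarNJ : J → J → J → ℝ
    polarNJ (β , t) (β' , t') (β'' , t'') = β * ⟪ t' , t'' ⟫ + β' * ⟪ t , t'' ⟫ + β'' * ⟪ t , t' ⟫

    polarNJ-isSymTrilinear : IsSymTrilinearForm Jops polarNJ
    polarNJ-isSymTrilinear = swap₁₂ , swap₂₃ , additive , homogeneous
      where
      swap₁₂ : ∀ x y z → polarNJ x y z ≡ polarNJ y x z
      swap₁₂ (β , t) (β' , t') (β'' , t'') = cong₂ _+_ (+-comm _ _) (cong (β'' *_) (⟪⟫-sym t t'))
      swap₂₃ : ∀ x y z → polarNJ x y z ≡ polarNJ x z y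
      swap₂₃ (β , t) (β' , t') (β'' , t'') =
        trans (cong (λ w → β * w + β' * ⟪ t , t'' ⟫ + β'' * ⟪ t , t' ⟫) (⟪⟫-sym t' t''))
              (solve 3 (λ a b c → a :+ b :+ c := a :+ c :+ b) refl (β * ⟪ t'' , t' ⟫) (β' * ⟪ t , t'' ⟫) (β'' * ⟪ t , t' ⟫))
      additive : ∀ x x' y z → polarNJ (x ⊕J x') y z ≡ polarNJ x y z + polarNJ x' y z
      additive (β , t) (β₀ , t₀) (β' , t') (β'' , t'') =
        trans (cong₂ (λ u v → (β + β₀) * ⟪ t' , t'' ⟫ + β' * u + β'' * v) (⟪⟫-+ˡ t t₀ t'') (⟪⟫-+ˡ t t₀ t'))
              (solve 9 (λ b b₀ b' b'' p u u₀ v v₀ →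
                          (b :+ b₀) :* p :+ b' :* (u :+ u₀) :+ b'' :* (v :+ v₀)
                          := (b :* p :+ b' :* u :+ b'' :* v) :+ (b₀ :* p :+ b' :* u₀ :+ b'' :* v₀))
                     refl β β₀ β' β'' ⟪ t' , t'' ⟫ ⟪ t , t'' ⟫ ⟪ t₀ , t'' ⟫ ⟪ t , t' ⟫ ⟪ t₀ , t' ⟫)
      homogeneous : ∀ c x y z → polarNJ (c ⊙J x) y z ≡ c * polarNJ x y z
      homogeneous c (β , t) (β' , t') (β'' , t'') =
        trans (cong₂ (λ u v → c * β * ⟪ t' , t'' ⟫ + β' * u + β'' * v) (⟪⟫-·ˡ c t t'') (⟪⟫-·ˡ c t t'))
              (solve 7 (λ c b b' b'' p u v → c :* b :* p :+ b' :* (c :* u) :+ b'' :* (c :* v)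
                                              := c :* (b :* p :+ b' :* u :+ b'' :* v))
                     refl c β β' β'' ⟪ t' , t'' ⟫ ⟪ t , t'' ⟫ ⟪ t , t' ⟫)

    polarNJ-diagonal : ∀ x → polarNJ x x x ≡ 6# * NJ x
    polarNJ-diagonal (β , t) =
      trans (cong (λ p → β * p + β * p + β * p) (⟪⟫-diagonal t))
            (solve 2 (λ b a → b :* (:2 :* a) :+ b :* (:2 :* a) :+ b :* (:2 :* a) := :6 :* (b :* a)) refl β (q t))

    polarNJ-1J-1J : ∀ β t → polarNJ 1J 1J (β , t) ≡ 2# * (β + ⟪ t , 1S ⟫)
    polarNJ-1J-1J β t =
      trans (cong₂ (λ a c → 1# * a + 1# * a + β * c) (⟪⟫-sym 1S t) ⟪1,1⟫)
            (solve 2 (λ b a → :1 :* a :+ :1 :* a :+ b :* :2 := :2 :* (b :+ a)) refl β ⟪ t , 1S ⟫)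

    polarNJ-1J : ∀ β t β' t' → polarNJ 1J (β , t) (β' , t') ≡ ⟪ t , t' ⟫ + β * ⟪ t' , 1S ⟫ + β' * ⟪ t , 1S ⟫
    polarNJ-1J β t β' t' =
      cong₂ _+_ (cong₂ _+_ (*-identityˡ ⟪ t , t' ⟫) (cong (β *_) (⟪⟫-sym 1S t'))) (cong (β' *_) (⟪⟫-sym 1S t))

    NJ-1J : NJ 1J ≡ 1#
    NJ-1J = trans (cong (1# *_) q1) (*-identityˡ 1#)

    #J-1J : #J 1J ≡ 1J
    #J-1J = cong₂ _,_ q1 (trans (cong (1# ·ᵥ_) ι-1) (·ᵥ-identityˡ 1S))

    -- The left-hand side is the cross product 1J × x, spelled out as in IsCubicNormStructure.
    cross-1J : ∀ x → #J (1J ⊕J x) ⊕J (((- 1#) ⊙J #J 1J) ⊕J ((- 1#) ⊙J #J x))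
                     ≡ (formJ 1J x ⊙J 1J) ⊕J ((- 1#) ⊙J x)
    cross-1J (β , t) = cong₂ _,_ scalar vector
      where
      scalar : q (1S +ᵥ t) + ((- 1#) * q 1S + (- 1#) * q t) ≡ (1# * β + ⟪ 1S , ι t ⟫) * 1# + (- 1#) * β
      scalar = begin
        q (1S +ᵥ t) + ((- 1#) * q 1S + (- 1#) * q t)
          ≡⟨ cong (_+ ((- 1#) * q 1S + (- 1#) * q t)) (q-+ 1S t) ⟩
        q 1S + ⟪ 1S , t ⟫ + q t + ((- 1#) * q 1S + (- 1#) * q t)
          ≡⟨ solve 3 (λ a p b → a :+ p :+ b :+ ((:- :1) :* a :+ (:- :1) :* b) := p) refl (q 1S) ⟪ 1S , t ⟫ (q t) ⟩
        ⟪ 1S , t ⟫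
          ≡⟨ trans (⟪1,ι⟫ t) (⟪⟫-sym t 1S) ⟨
        ⟪ 1S , ι t ⟫
          ≡⟨ solve 2 (λ b p → p := (:1 :* b :+ p) :* :1 :+ (:- :1) :* b) refl β ⟪ 1S , ι t ⟫ ⟩
        (1# * β + ⟪ 1S , ι t ⟫) * 1# + (- 1#) * β
          ∎
      vector : (1# + β) ·ᵥ ι (1S +ᵥ t) +ᵥ ((- 1#) ·ᵥ (1# ·ᵥ ι 1S) +ᵥ (- 1#) ·ᵥ (β ·ᵥ ι t))
               ≡ (1# * β + ⟪ 1S , ι t ⟫) ·ᵥ 1S +ᵥ (- 1#) ·ᵥ t
      vector = begin
        (1# + β) ·ᵥ ι (1S +ᵥ t) +ᵥ ((- 1#) ·ᵥ (1# ·ᵥ ι 1S) +ᵥ (- 1#) ·ᵥ (β ·ᵥ ι t))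
          ≡⟨ cong₂ (λ u v → (1# + β) ·ᵥ u +ᵥ ((- 1#) ·ᵥ (1# ·ᵥ v) +ᵥ (- 1#) ·ᵥ (β ·ᵥ ι t)))
                   (trans (ι-+ 1S t) (cong (_+ᵥ ι t) ι-1)) ι-1 ⟩
        (1# + β) ·ᵥ (1S +ᵥ ι t) +ᵥ ((- 1#) ·ᵥ (1# ·ᵥ 1S) +ᵥ (- 1#) ·ᵥ (β ·ᵥ ι t))
          ≡⟨ cong (λ w → (1# + β) ·ᵥ (1S +ᵥ w) +ᵥ ((- 1#) ·ᵥ (1# ·ᵥ 1S) +ᵥ (- 1#) ·ᵥ (β ·ᵥ w))) (ι-formula t) ⟩
        (1# + β) ·ᵥ (1S +ᵥ ιt) +ᵥ ((- 1#) ·ᵥ (1# ·ᵥ 1S) +ᵥ (- 1#) ·ᵥ (β ·ᵥ ιt))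
          ≡⟨ collect β ⟪ t , 1S ⟫ 1S t ⟩
        (1# * β + ⟪ t , 1S ⟫) ·ᵥ 1S +ᵥ (- 1#) ·ᵥ t
          ≡⟨ cong (λ c → (1# * β + c) ·ᵥ 1S +ᵥ (- 1#) ·ᵥ t) (⟪1,ι⟫ t) ⟨
        (1# * β + ⟪ 1S , ι t ⟫) ·ᵥ 1S +ᵥ (- 1#) ·ᵥ t
          ∎
        where
        ιt : Vec ℝ n
        ιt = ⟪ t , 1S ⟫ ·ᵥ 1S +ᵥ (- 1#) ·ᵥ t
        collect : ∀ {m} b p (o x : Vec ℝ m) →
                  (1# + b) ·ᵥ (o +ᵥ (p ·ᵥ o +ᵥ (- 1#) ·ᵥ x)) +ᵥ ((- 1#) ·ᵥ (1# ·ᵥ o) +ᵥ (- 1#) ·ᵥ (b ·ᵥ (p ·ᵥ o +ᵥ (- 1#) ·ᵥ x)))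
                  ≡ (1# * b + p) ·ᵥ o +ᵥ (- 1#) ·ᵥ x
        collect b p []      []      = refl
        collect b p (o ∷ w) (x ∷ v) = cong₂ _∷_
          (solve 4 (λ b p o x → (:1 :+ b) :* (o :+ (p :* o :+ (:- :1) :* x)) :+ ((:- :1) :* (:1 :* o) :+ (:- :1) :* (b :* (p :* o :+ (:- :1) :* x)))
                                := (:1 :* b :+ p) :* o :+ (:- :1) :* x) refl b p o x)
          (collect b p w v)

    #J-#J : ∀ x → #J (#J x) ≡ NJ x ⊙J x
    #J-#J (β , t) = cong₂ _,_ scalar vector
      where
      scalar : q (β ·ᵥ ι t) ≡ β * q t * β
      scalar = begin
        q (β ·ᵥ ι t)       ≡⟨ q-· β (ι t) ⟩
        β * β * q (ι t)    ≡⟨ cong (β * β *_) (q-ι t) ⟩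
        β * β * q t        ≡⟨ solve 2 (λ b a → b :* b :* a := b :* a :* b) refl β (q t) ⟩
        β * q t * β        ∎
      vector : q t ·ᵥ ι (β ·ᵥ ι t) ≡ (β * q t) ·ᵥ t
      vector = begin
        q t ·ᵥ ι (β ·ᵥ ι t)     ≡⟨ cong (q t ·ᵥ_) (trans (ι-· β (ι t)) (cong (β ·ᵥ_) (ι-involutive t))) ⟩
        q t ·ᵥ (β ·ᵥ t)         ≡⟨ ·ᵥ-comm (q t) β t ⟩
        β ·ᵥ (q t ·ᵥ t)         ≡⟨ *-·ᵥ-assoc β (q t) t ⟨
        (β * q t) ·ᵥ t          ∎

    trace-formJ : ∀ x y → 4# * formJ x y ≡ polarNJ 1J 1J x * polarNJ 1J 1J y - 4# * polarNJ 1J x y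
    trace-formJ (β , t) (β' , t') = begin
      4# * (β * β' + ⟪ t , ι t' ⟫)
        ≡⟨ cong (λ w → 4# * (β * β' + w)) (⟪ι⟫ʳ t t') ⟩
      4# * (β * β' + (a * a' - ⟪ t , t' ⟫))
        ≡⟨ solve 5 (λ b b' a a' c → :4 :* (b :* b' :+ (a :* a' :- c))
                                    := :2 :* (b :+ a) :* (:2 :* (b' :+ a')) :- :4 :* (c :+ b :* a' :+ b' :* a))
                 refl β β' a a' ⟪ t , t' ⟫ ⟩
      2# * (β + a) * (2# * (β' + a')) - 4# * (⟪ t , t' ⟫ + β * a' + β' * a)
        ≡⟨ cong₂ (λ u v → u - 4# * v) (cong₂ _*_ (polarNJ-1J-1J β t) (polarNJ-1J-1J β' t')) (polarNJ-1J β t β' t') ⟨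
      polarNJ 1J 1J (β , t) * polarNJ 1J 1J (β' , t') - 4# * polarNJ 1J (β , t) (β' , t')
        ∎
      where
      a a' : ℝ
      a  = ⟪ t , 1S ⟫
      a' = ⟪ t' , 1S ⟫

    NJ-+ : ∀ x y → NJ (x ⊕J y) ≡ NJ x + formJ (#J x) y + formJ x (#J y) + NJ y
    NJ-+ (β , t) (β' , t') = begin
      (β + β') * q (t +ᵥ t')
        ≡⟨ cong ((β + β') *_) (q-+ t t') ⟩
      (β + β') * (q t + ⟪ t , t' ⟫ + q t')
        ≡⟨ solve 5 (λ b b' a p a' → (b :+ b') :* (a :+ p :+ a')
                                    := b :* a :+ (a :* b' :+ b :* p) :+ (b :* a' :+ b' :* p) :+ b' :* a')
                 refl β β' (q t) ⟪ t , t' ⟫ (q t') ⟩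
      β * q t + (q t * β' + β * ⟪ t , t' ⟫) + (β * q t' + β' * ⟪ t , t' ⟫) + β' * q t'
        ≡⟨ cong₂ (λ u v → β * q t + (q t * β' + u) + (β * q t' + v) + β' * q t') #x-y #y-x ⟨
      β * q t + (q t * β' + ⟪ β ·ᵥ ι t , ι t' ⟫) + (β * q t' + ⟪ t , ι (β' ·ᵥ ι t') ⟫) + β' * q t'
        ∎
      where
      #x-y : ⟪ β ·ᵥ ι t , ι t' ⟫ ≡ β * ⟪ t , t' ⟫
      #x-y = trans (⟪⟫-·ˡ β (ι t) (ι t')) (cong (β *_) (⟪ι,ι⟫ t t'))
      #y-x : ⟪ t , ι (β' ·ᵥ ι t') ⟫ ≡ β' * ⟪ t , t' ⟫
      #y-x = trans (cong ⟪ t ,_⟫ (trans (ι-· β' (ι t')) (cong (β' ·ᵥ_) (ι-involutive t')))) (⟪⟫-·ʳ β' t t')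

    J-isCubicNormStructure : IsCubicNormStructure Jops NJ #J 1J formJ
    J-isCubicNormStructure =
      #J-isQuadraticMap , formJ-isSymBilinear , polarNJ , polarNJ-isSymTrilinear , polarNJ-diagonal ,
      NJ-1J , #J-1J , cross-1J , #J-#J , trace-formJ , NJ-+

    polarV-coordinates : ∀ α s β γ t δ → ((α , s , β) , (γ , t , δ) ⟩V) ≡ α * δ + γ * β - ⟪ s , t ⟫
    polarV-coordinates α s β γ t δ =
      solve 7 (λ α β γ δ u a b → (α :+ γ) :* (β :+ δ) :- u :- (α :* β :- a) :- (γ :* δ :- b)
                                 := α :* δ :+ γ :* β :- (u :- a :- b))
            refl α β γ δ (q (s +ᵥ t)) (q s) (q t)

    formJ-ιʳ : ∀ a x b y → formJ (a , x) (b , ι y) ≡ a * b + ⟪ x , y ⟫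
    formJ-ιʳ a x b y = cong (λ z → a * b + ⟪ x , z ⟫) (ι-involutive y)

    formJ-ιˡ : ∀ a x b y → formJ (a , ι x) (b , y) ≡ a * b + ⟪ x , y ⟫
    formJ-ιˡ a x b y = cong (a * b +_) (⟪ι,ι⟫ x y)

    formJ-#-# : ∀ a x b y → formJ (#J (a , x)) (#J (b , ι y)) ≡ q x * q y + a * b * ⟪ x , y ⟫
    formJ-#-# a x b y = begin
      q x * q (ι y) + ⟪ a ·ᵥ ι x , ι (b ·ᵥ ι (ι y)) ⟫
        ≡⟨ cong₂ (λ u v → q x * u + ⟪ a ·ᵥ ι x , v ⟫) (q-ι y) (trans (ι-· b (ι (ι y))) (cong (b ·ᵥ_) (ι-involutive (ι y)))) ⟩
      q x * q y + ⟪ a ·ᵥ ι x , b ·ᵥ ι y ⟫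
        ≡⟨ cong (q x * q y +_) (trans (⟪⟫-·ˡ a (ι x) (b ·ᵥ ι y)) (cong (a *_) (⟪⟫-·ʳ b (ι x) (ι y)))) ⟩
      q x * q y + a * (b * ⟪ ι x , ι y ⟫)
        ≡⟨ cong (λ w → q x * q y + w) (trans (sym (*-assoc a b _)) (cong (a * b *_) (⟪ι,ι⟫ x y))) ⟩
      q x * q y + a * b * ⟪ x , y ⟫
        ∎

    sympW-φ : ∀ X Y → sympW (φ X) (φ Y) ≡ sympV X Y
    sympW-φ ((α , s , β) , (γ , t , δ)) ((α' , s' , β') , (γ' , t' , δ')) = begin
      α * δ' - formJ (γ , s) (β' , ι t') + formJ (β , ι t) (γ' , s') - δ * α'
        ≡⟨ cong₂ (λ u v → α * δ' - u + v - δ * α') (formJ-ιʳ γ s β' t') (formJ-ιˡ β t γ' s') ⟩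
      α * δ' - (γ * β' + ⟪ s , t' ⟫) + (β * γ' + ⟪ t , s' ⟫) - δ * α'
        ≡⟨ solve 10 (λ α β γ δ α' β' γ' δ' u v →
                       α :* δ' :- (γ :* β' :+ u) :+ (β :* γ' :+ v) :- δ :* α'
                       := (α :* δ' :+ γ' :* β :- u) :- (γ :* β' :+ α' :* δ :- v))
                 refl α β γ δ α' β' γ' δ' ⟪ s , t' ⟫ ⟪ t , s' ⟫ ⟩
      (α * δ' + γ' * β - ⟪ s , t' ⟫) - (γ * β' + α' * δ - ⟪ t , s' ⟫)
        ≡⟨ cong₂ _-_ (polarV-coordinates α s β γ' t' δ') (polarV-coordinates γ t δ α' s' β') ⟨
      sympV ((α , s , β) , (γ , t , δ)) ((α' , s' , β') , (γ' , t' , δ'))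
        ∎

    qW-φ : ∀ X → qW (φ X) ≡ QV X
    qW-φ ((α , s , β) , (γ , t , δ)) = begin
      (α * δ - formJ (γ , s) (β , ι t)) ² + 4# * α * NJ (β , ι t) + 4# * δ * NJ (γ , s)
        - 4# * formJ (#J (γ , s)) (#J (β , ι t))
        ≡⟨ cong₂ (λ u v → (α * δ - u) ² + 4# * α * (β * v) + 4# * δ * (γ * q s) - 4# * formJ (#J (γ , s)) (#J (β , ι t)))
                 (formJ-ιʳ γ s β t) (q-ι t) ⟩
      (α * δ - (γ * β + ⟪ s , t ⟫)) ² + 4# * α * (β * q t) + 4# * δ * (γ * q s)
        - 4# * formJ (#J (γ , s)) (#J (β , ι t))
        ≡⟨ cong (λ w → (α * δ - (γ * β + ⟪ s , t ⟫)) ² + 4# * α * (β * q t) + 4# * δ * (γ * q s) - 4# * w)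
                (formJ-#-# γ s β t) ⟩
      (α * δ - (γ * β + ⟪ s , t ⟫)) ² + 4# * α * (β * q t) + 4# * δ * (γ * q s)
        - 4# * (q s * q t + γ * β * ⟪ s , t ⟫)
        ≡⟨ solve 7 (λ α β γ δ a b p →
                      (α :* δ :- (γ :* β :+ p)) :* (α :* δ :- (γ :* β :+ p)) :+ :4 :* α :* (β :* b) :+ :4 :* δ :* (γ :* a)
                        :- :4 :* (a :* b :+ γ :* β :* p)
                      := (α :* δ :+ γ :* β :- p) :* (α :* δ :+ γ :* β :- p) :- :4 :* (α :* β :- a) :* (γ :* δ :- b))
                 refl α β γ δ (q s) (q t) ⟪ s , t ⟫ ⟩
      (α * δ + γ * β - ⟪ s , t ⟫) ² - 4# * (α * β - q s) * (γ * δ - q t)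
        ≡⟨ cong (λ w → w ² - 4# * (α * β - q s) * (γ * δ - q t)) (polarV-coordinates α s β γ t δ) ⟨
      QV ((α , s , β) , (γ , t , δ))
        ∎

theoremA1 : (R : RealField) → let open WithReals R in
    (r : ℕ) (qS : Vec ℝ (suc r) → ℝ) → HasSignature1 r qS →
    (1S : Vec ℝ (suc r)) → qS 1S ≡ 1# →
    (ι : Vec ℝ (suc r) → Vec ℝ (suc r)) → IsStdInvolution qS 1S ι →
    let open Construction qS 1S ι in
    IsCubicNormStructure Jops NJ #J 1J formJ ×
    (∀ X Y → sympW (φ X) (φ Y) ≡ sympV X Y) ×
    (∀ X → qW (φ X) ≡ QV X)
theoremA1 R r qS signature 1S q1 ι isStd =
  J-isCubicNormStructure R isQuad 1S q1 ι isStd ,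
  sympW-φ R isQuad 1S q1 ι isStd ,
  qW-φ R isQuad 1S q1 ι isStd
  where
  isQuad : IsQuadraticForm R qS
  isQuad = signature⇒isQuadraticForm R signature
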